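{- If $f\colon A\vdash B$ is the code of a derivation in $\mathcal{IL}$, then there is a cut-free derivation in $\mathcal{IL}$ of the sequent $A\vdash B$ whose code is a term equal to $f$.
   Context: Formulae are built from an infinite set of propositional letters and a constant $I$ using binary connectives $\otimes$ and $\to$. An $\alpha$-formula is a formula considered up to strict associativity of $\otimes$ and strict unitality of $I$ ($A\otimes(B\otimes C)=(A\otimes B)\otimes C$, $A\otimes I=I\otimes A=A$, also inside subformulae); so $\otimes$ is an operation on $\alpha$-formulae with unit $I$. System $\mathcal{IL}$: sequents $G\vdash A$ with $G,A$ $\alpha$-formulae. Axioms $A\vdash A$. Rules (all letters denote $\alpha$-formulae, possibly $I$): interchange: from $G\otimes A\otimes B\otimes E\vdash D$ infer $G\otimes B\otimes A\otimes E\vdash D$; cut: from $C\vdash A$ and $G\otimes A\otimes E\vdash D$ infer $G\otimes C\otimes E\vdash D$; $(\to\vdash)$: from $C\vdash A$ and $B\otimes G\vdash D$ infer $C\otimes(A\to B)\otimes G\vdash D$; $(\vdash\to)$: from $A\otimes G\vdash C$ infer $G\vdash A\to C$; $(\otimes\vdash\otimes)$: from $A\vdash C$ and $B\vdash E$ infer $A\otimes B\vdash C\otimes E$. Terms with types $f\colon A\vdash B$: primitive $\mathbf 1_A\colon A\vdash A$, $c_{B,A}\colon B\otimes A\vdash A\otimes B$, $\eta_{A,B}\colon B\vdash A\to(A\otimes B)$, $\varepsilon_{A,B}\colon A\otimes(A\to B)\vdash B$; closed under $g\circ f$ (for $f\colon A\vdash B$, $g\colon B\vdash C$), $f_1\otimes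 f_2\colon A_1\otimes A_2\vdash B_1\otimes B_2$, and $A\to f\colon A\to B_1\vdash A\to B_2$ (for $f\colon B_1\vdash B_2$); strictly $f\otimes(g\otimes h)=(f\otimes g)\otimes h$, $f\otimes\mathbf 1_I=\mathbf 1_I\otimes f=f$. Equality of terms is the smallest congruence (w.r.t. $\circ,\otimes,A\to$; only between terms of the same type) containing: $g\circ\mathbf 1_A=g$, $\mathbf 1_A\circ f=f$; $h\circ(g\circ f)=(h\circ g)\circ f$; $\mathbf 1_A\otimes\mathbf 1_B=\mathbf 1_{A\otimes B}$; $(g_1\otimes g_2)\circ(f_1\otimes f_2)=(g_1\circ f_1)\otimes(g_2\circ f_2)$; $c_{A',B'}\circ(f\otimes g)=(g\otimes f)\circ c_{A,B}$ ($f\colon A\vdash A'$, $g\colon B\vdash B'$); $c_{B,A}\circ c_{A,B}=\mathbf 1_{A\otimes B}$; $c_{A\otimes B,C}=(c_{A,C}\otimes\mathbf 1_B)\circ(\mathbf 1_A\otimes c_{B,C})$; $A\to(g\circ f)=(A\to g)\circ(A\to f)$; $\eta_{A,B'}\circ f=(A\to(\mathbf 1_A\otimes f))\circ\eta_{A,B}$ ($f\colon B\vdash B'$); $A\to\mathbf 1_B=\mathbf 1_{A\to B}$; $\varepsilon_{A,B'}\circ(\mathbf 1_A\otimes(A\to f))=f\circ\varepsilon_{A,B}$ ($f\colon B\vdash B'$); $\varepsilon_{A,A\otimes B}\circ(\mathbf 1_A\otimes\eta_{A,B})=\mathbf 1_{A\otimes B}$; $(A\to\varepsilon_{A,B})\circ\eta_{A,A\to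 B}=\mathbf 1_{A\to B}$. Coding of derivations: an axiom $A\vdash A$ is coded by $\mathbf 1_A$; if the premises are coded by $f$ (and $g$): interchange gives $f\circ(\mathbf 1_G\otimes c_{B,A}\otimes\mathbf 1_E)$; cut (left premise $f\colon C\vdash A$, right $g$) gives $g\circ(\mathbf 1_G\otimes f\otimes\mathbf 1_E)$; $(\to\vdash)$ with $f\colon C\vdash A$, $g\colon B\otimes G\vdash D$ gives $g\circ(\varepsilon_{A,B}\otimes\mathbf 1_G)\circ(f\otimes\mathbf 1_{A\to B}\otimes\mathbf 1_G)$; $(\vdash\to)$ with $f\colon A\otimes G\vdash C$ gives $(A\to f)\circ\eta_{A,G}$; $(\otimes\vdash\otimes)$ gives $f\otimes g$. A derivation is cut-free if it contains no cut. -}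

module Defs where

open import Data.Nat using (ℕ)
open import Data.List using (List; []; _∷_; [_]; _++_)
open import Data.Product using (Σ; _×_; _,_)

-- An α-formula is a formula up to strict associativity of ⊗ and strict
-- unitality of I (also inside subformulae).  We use the canonical
-- representative: an α-formula is a list of "factors" (the ⊗-product of
-- the factors), each factor being a propositional letter or an
-- implication between α-formulae.

infixr 30 _⇒_

data Factor : Set where
  var : ℕ → Factor
  _⇒_ : List Factor → List Factor → Factor

Fm : Set
Fm = List Factor

I : Fm
I = []

_⊗_ : Fm → Fm → Fm
A ⊗ B = A ++ B

_⊸_ : Fm → Fm → Fm
A ⊸ B = [ A ⇒ B ]

data Term : Set where
  𝟙    : Fm → Term
  c    : Fm → Fm → Term
  η    : Fm → Fm → Term
  ε    : Fm → Fm → Term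
  _∘_  : Term → Term → Term
  _⊗ᵗ_ : Term → Term → Term
  arr  : Fm → Term → Term

infixr 9 _∘_
infixr 8 _⊗ᵗ_

infix 4 _∶_⊢_
data _∶_⊢_ : Term → Fm → Fm → Set where
  t𝟙   : ∀ A → 𝟙 A ∶ A ⊢ A
  tc   : ∀ B A → c B A ∶ B ⊗ A ⊢ A ⊗ B
  tη   : ∀ A B → η A B ∶ B ⊢ A ⊸ (A ⊗ B)
  tε   : ∀ A B → ε A B ∶ A ⊗ (A ⊸ B) ⊢ B
  t∘   : ∀ {f g A B C} → f ∶ A ⊢ B → g ∶ B ⊢ C → g ∘ f ∶ A ⊢ C
  t⊗   : ∀ {f₁ f₂ A₁ A₂ B₁ B₂} → f₁ ∶ A₁ ⊢ B₁ → f₂ ∶ A₂ ⊢ B₂ →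
         f₁ ⊗ᵗ f₂ ∶ A₁ ⊗ A₂ ⊢ B₁ ⊗ B₂
  tarr : ∀ {f B₁ B₂} A → f ∶ B₁ ⊢ B₂ → arr A f ∶ A ⊸ B₁ ⊢ A ⊸ B₂

-- The smallest congruence (w.r.t. ∘, ⊗, A → _) on typed terms containing
-- the listed equations; the strict laws for ⊗ on terms
-- (f⊗(g⊗h) = (f⊗g)⊗h, f⊗1_I = 1_I⊗f = f) are included as generators,
-- which amounts to working on terms modulo those strict identifications.

data TmEq : Fm → Fm → Term → Term → Set where
  ≈refl  : ∀ {A B f} → f ∶ A ⊢ B → TmEq A B f f
  ≈sym   : ∀ {A B f g} → TmEq A B f g → TmEq A B g f
  ≈trans : ∀ {A B f g h} → TmEq A B f g → TmEq A B g h → TmEq A B f h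
  ≈∘     : ∀ {A B C f f' g g'} → TmEq A B f f' → TmEq B C g g' →
           TmEq A C (g ∘ f) (g' ∘ f')
  ≈⊗     : ∀ {A₁ A₂ B₁ B₂ f f' g g'} → TmEq A₁ B₁ f f' → TmEq A₂ B₂ g g' →
           TmEq (A₁ ⊗ A₂) (B₁ ⊗ B₂) (f ⊗ᵗ g) (f' ⊗ᵗ g')
  ≈arr   : ∀ {B₁ B₂ f f'} A → TmEq B₁ B₂ f f' →
           TmEq (A ⊸ B₁) (A ⊸ B₂) (arr A f) (arr A f')
  ⊗-assoc  : ∀ {f g h A₁ A₂ A₃ B₁ B₂ B₃} →
             f ∶ A₁ ⊢ B₁ → g ∶ A₂ ⊢ B₂ → h ∶ A₃ ⊢ B₃ →
             TmEq (A₁ ⊗ (A₂ ⊗ A₃)) (B₁ ⊗ (B₂ ⊗ B₃))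
                  (f ⊗ᵗ (g ⊗ᵗ h)) ((f ⊗ᵗ g) ⊗ᵗ h)
  ⊗-unitʳ  : ∀ {f A B} → f ∶ A ⊢ B → TmEq A B (f ⊗ᵗ 𝟙 I) f
  ⊗-unitˡ  : ∀ {f A B} → f ∶ A ⊢ B → TmEq A B (𝟙 I ⊗ᵗ f) f
  idʳ    : ∀ {g A B} → g ∶ A ⊢ B → TmEq A B (g ∘ 𝟙 A) g
  idˡ    : ∀ {f A B} → f ∶ A ⊢ B → TmEq A B (𝟙 B ∘ f) f
  assoc  : ∀ {f g h A B C D} → f ∶ A ⊢ B → g ∶ B ⊢ C → h ∶ C ⊢ D →
           TmEq A D (h ∘ (g ∘ f)) ((h ∘ g) ∘ f)
  ⊗-id   : ∀ A B → TmEq (A ⊗ B) (A ⊗ B) (𝟙 A ⊗ᵗ 𝟙 B) (𝟙 (A ⊗ B))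
  ⊗-∘    : ∀ {f₁ f₂ g₁ g₂ A₁ A₂ B₁ B₂ C₁ C₂} →
           f₁ ∶ A₁ ⊢ B₁ → f₂ ∶ A₂ ⊢ B₂ → g₁ ∶ B₁ ⊢ C₁ → g₂ ∶ B₂ ⊢ C₂ →
           TmEq (A₁ ⊗ A₂) (C₁ ⊗ C₂)
                ((g₁ ⊗ᵗ g₂) ∘ (f₁ ⊗ᵗ f₂)) ((g₁ ∘ f₁) ⊗ᵗ (g₂ ∘ f₂))
  c-nat  : ∀ {f g A A' B B'} → f ∶ A ⊢ A' → g ∶ B ⊢ B' →
           TmEq (A ⊗ B) (B' ⊗ A') (c A' B' ∘ (f ⊗ᵗ g)) ((g ⊗ᵗ f) ∘ c A B)
  c-inv  : ∀ A B → TmEq (A ⊗ B) (A ⊗ B) (c B A ∘ c A B) (𝟙 (A ⊗ B))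
  c-hex  : ∀ A B C → TmEq ((A ⊗ B) ⊗ C) (C ⊗ (A ⊗ B))
                          (c (A ⊗ B) C)
                          ((c A C ⊗ᵗ 𝟙 B) ∘ (𝟙 A ⊗ᵗ c B C))
  arr-∘  : ∀ {f g B₁ B₂ B₃} A → f ∶ B₁ ⊢ B₂ → g ∶ B₂ ⊢ B₃ →
           TmEq (A ⊸ B₁) (A ⊸ B₃) (arr A (g ∘ f)) (arr A g ∘ arr A f)
  arr-id : ∀ A B → TmEq (A ⊸ B) (A ⊸ B) (arr A (𝟙 B)) (𝟙 (A ⊸ B))
  η-nat  : ∀ {f B B'} A → f ∶ B ⊢ B' →
           TmEq B (A ⊸ (A ⊗ B')) (η A B' ∘ f) (arr A (𝟙 A ⊗ᵗ f) ∘ η A B)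
  ε-nat  : ∀ {f B B'} A → f ∶ B ⊢ B' →
           TmEq (A ⊗ (A ⊸ B)) B' (ε A B' ∘ (𝟙 A ⊗ᵗ arr A f)) (f ∘ ε A B)
  tri₁   : ∀ A B → TmEq (A ⊗ B) (A ⊗ B)
                        (ε A (A ⊗ B) ∘ (𝟙 A ⊗ᵗ η A B)) (𝟙 (A ⊗ B))
  tri₂   : ∀ A B → TmEq (A ⊸ B) (A ⊸ B)
                        (arr A (ε A B) ∘ η A (A ⊸ B)) (𝟙 (A ⊸ B))

data Deriv : Fm → Fm → Set where
  ax    : ∀ A → Deriv A A
  inter : ∀ G A B E {D} → Deriv (G ⊗ (A ⊗ (B ⊗ E))) D →
          Deriv (G ⊗ (B ⊗ (A ⊗ E))) D
  cut   : ∀ G C A E {D} → Deriv C A → Deriv (G ⊗ (A ⊗ E)) D →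
          Deriv (G ⊗ (C ⊗ E)) D
  →⊢    : ∀ C A B G {D} → Deriv C A → Deriv (B ⊗ G) D →
          Deriv (C ⊗ ((A ⊸ B) ⊗ G)) D
  ⊢→    : ∀ A G C → Deriv (A ⊗ G) C → Deriv G (A ⊸ C)
  ⊗⊢⊗   : ∀ A B C E → Deriv A C → Deriv B E → Deriv (A ⊗ B) (C ⊗ E)

code : ∀ {G D} → Deriv G D → Term
code (ax A)             = 𝟙 A
code (inter G A B E d)  = code d ∘ (𝟙 G ⊗ᵗ (c B A ⊗ᵗ 𝟙 E))
code (cut G C A E f g)  = code g ∘ (𝟙 G ⊗ᵗ (code f ⊗ᵗ 𝟙 E))
code (→⊢ C A B G f g)   =
  code g ∘ ((ε A B ⊗ᵗ 𝟙 G) ∘ (code f ⊗ᵗ (𝟙 (A ⊸ B) ⊗ᵗ 𝟙 G)))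
code (⊢→ A G C f)       = arr A (code f) ∘ η A G
code (⊗⊢⊗ A B C E f g)  = code f ⊗ᵗ code g

data CutFree : ∀ {G D} → Deriv G D → Set where
  cf-ax    : ∀ A → CutFree (ax A)
  cf-inter : ∀ G A B E {D} {d : Deriv (G ⊗ (A ⊗ (B ⊗ E))) D} →
             CutFree d → CutFree (inter G A B E d)
  cf-→⊢    : ∀ C A B G {D} {f : Deriv C A} {g : Deriv (B ⊗ G) D} →
             CutFree f → CutFree g → CutFree (→⊢ C A B G f g)
  cf-⊢→    : ∀ A G C {f : Deriv (A ⊗ G) C} →
             CutFree f → CutFree (⊢→ A G C f)
  cf-⊗⊢⊗   : ∀ A B C E {f : Deriv A C} {g : Deriv B E} →
             CutFree f → CutFree g → CutFree (⊗⊢⊗ A B C E f g)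

{-# OPTIONS --safe #-}

-- Gentzen's cut elimination, carried out on derivations paired with their
-- codes.  A cut on A is permuted upwards through its left premise, which
-- breaks A into the implications introduced there by (⊢→).  A cut on such an
-- implication A₁ → B₁ is then permuted upwards through the right premise until
-- A₁ → B₁ is introduced on the left, where it is replaced by cuts on A₁ and on
-- B₁, so the size of the cut formula decreases.  Every permutation preserves
-- the code: the commuting steps by bifunctoriality of ⊗ and naturality of c,
-- η and ε, the principal step by naturality of ε and the triangle law
-- ε ∘ (1 ⊗ η) = 1, i.e. β-conversion.

module Submission where

open import Defs
open import Data.Product using (Σ; _×_)
open import Relation.Binary.PropositionalEquality using (_≡_)

open import Algebra.Bundles using (Monoid)
open import Data.List using ([]; _∷_; _++_)
open import Data.List.Properties using (++-assoc; ++-identityʳ; ++-monoid; ∷-injective)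
open import Data.Nat using (ℕ; zero; suc; _+_; _≤_; s≤s)
open import Data.Nat.Properties using (≤-refl; +-assoc; m+n≤o⇒m≤o; m+n≤o⇒n≤o)
open import Data.Product using (_,_; proj₁; proj₂)
open import Relation.Binary.Bundles using (Setoid)
open import Relation.Binary.PropositionalEquality using (refl; sym; trans; cong; cong₂; subst)
open import Tactic.MonoidSolver using (solve)

Fm-monoid : Monoid _ _
Fm-monoid = ++-monoid Factor

++-assoc₃ : ∀ (A B C D : Fm) → (A ⊗ (B ⊗ C)) ⊗ D ≡ A ⊗ (B ⊗ (C ⊗ D))
++-assoc₃ A B C D = trans (++-assoc A (B ⊗ C) D) (cong (A ⊗_) (++-assoc B C D))

⊢-cast : ∀ {f A A′ B B′} → A ≡ A′ → B ≡ B′ → f ∶ A ⊢ B → f ∶ A′ ⊢ B′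
⊢-cast refl refl t = t

TmEq-cast : ∀ {f g A A′ B B′} → A ≡ A′ → B ≡ B′ → TmEq A B f g → TmEq A′ B′ f g
TmEq-cast refl refl e = e

⊢-unique : ∀ {f A A′ B B′} → f ∶ A ⊢ B → f ∶ A′ ⊢ B′ → A ≡ A′ × B ≡ B′
⊢-unique (t𝟙 A) (t𝟙 .A) = refl , refl
⊢-unique (tc B A) (tc .B .A) = refl , refl
⊢-unique (tη A B) (tη .A .B) = refl , refl
⊢-unique (tε A B) (tε .A .B) = refl , refl
⊢-unique (t∘ tf tg) (t∘ tf′ tg′) = proj₁ (⊢-unique tf tf′) , proj₂ (⊢-unique tg tg′)
⊢-unique (t⊗ tf tg) (t⊗ tf′ tg′) =
  cong₂ _++_ (proj₁ (⊢-unique tf tf′)) (proj₁ (⊢-unique tg tg′)) ,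
  cong₂ _++_ (proj₂ (⊢-unique tf tf′)) (proj₂ (⊢-unique tg tg′))
⊢-unique (tarr A tf) (tarr .A tf′) =
  cong (A ⊸_) (proj₁ (⊢-unique tf tf′)) , cong (A ⊸_) (proj₂ (⊢-unique tf tf′))

TmEq-⊢ : ∀ {A B f g} → TmEq A B f g → f ∶ A ⊢ B × g ∶ A ⊢ B
TmEq-⊢ (≈refl t) = t , t
TmEq-⊢ (≈sym e) = proj₂ (TmEq-⊢ e) , proj₁ (TmEq-⊢ e)
TmEq-⊢ (≈trans e e′) = proj₁ (TmEq-⊢ e) , proj₂ (TmEq-⊢ e′)
TmEq-⊢ (≈∘ e e′) = t∘ (proj₁ (TmEq-⊢ e)) (proj₁ (TmEq-⊢ e′)) , t∘ (proj₂ (TmEq-⊢ e)) (proj₂ (TmEq-⊢ e′))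
TmEq-⊢ (≈⊗ e e′) = t⊗ (proj₁ (TmEq-⊢ e)) (proj₁ (TmEq-⊢ e′)) , t⊗ (proj₂ (TmEq-⊢ e)) (proj₂ (TmEq-⊢ e′))
TmEq-⊢ (≈arr A e) = tarr A (proj₁ (TmEq-⊢ e)) , tarr A (proj₂ (TmEq-⊢ e))
TmEq-⊢ (⊗-assoc {A₁ = A₁} {A₂} {A₃} {B₁} {B₂} {B₃} tf tg th) =
  t⊗ tf (t⊗ tg th) , ⊢-cast (++-assoc A₁ A₂ A₃) (++-assoc B₁ B₂ B₃) (t⊗ (t⊗ tf tg) th)
TmEq-⊢ (⊗-unitʳ {A = A} {B} tf) = ⊢-cast (++-identityʳ A) (++-identityʳ B) (t⊗ tf (t𝟙 I)) , tf
TmEq-⊢ (⊗-unitˡ tf) = t⊗ (t𝟙 I) tf , tf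
TmEq-⊢ (idʳ {A = A} tg) = t∘ (t𝟙 A) tg , tg
TmEq-⊢ (idˡ {B = B} tf) = t∘ tf (t𝟙 B) , tf
TmEq-⊢ (assoc tf tg th) = t∘ (t∘ tf tg) th , t∘ tf (t∘ tg th)
TmEq-⊢ (⊗-id A B) = t⊗ (t𝟙 A) (t𝟙 B) , t𝟙 (A ⊗ B)
TmEq-⊢ (⊗-∘ tf₁ tf₂ tg₁ tg₂) = t∘ (t⊗ tf₁ tf₂) (t⊗ tg₁ tg₂) , t⊗ (t∘ tf₁ tg₁) (t∘ tf₂ tg₂)
TmEq-⊢ (c-nat {A = A} {A′} {B} {B′} tf tg) = t∘ (t⊗ tf tg) (tc A′ B′) , t∘ (tc A B) (t⊗ tg tf)
TmEq-⊢ (c-inv A B) = t∘ (tc A B) (tc B A) , t𝟙 (A ⊗ B)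
TmEq-⊢ (c-hex A B C) = tc (A ⊗ B) C ,
  t∘ (⊢-cast (sym (++-assoc A B C)) (sym (++-assoc A C B)) (t⊗ (t𝟙 A) (tc B C)))
     (⊢-cast refl (++-assoc C A B) (t⊗ (tc A C) (t𝟙 B)))
TmEq-⊢ (arr-∘ A tf tg) = tarr A (t∘ tf tg) , t∘ (tarr A tf) (tarr A tg)
TmEq-⊢ (arr-id A B) = tarr A (t𝟙 B) , t𝟙 (A ⊸ B)
TmEq-⊢ (η-nat {B = B} {B′} A tf) = t∘ tf (tη A B′) , t∘ (tη A B) (tarr A (t⊗ (t𝟙 A) tf))
TmEq-⊢ (ε-nat {B = B} {B′} A tf) = t∘ (t⊗ (t𝟙 A) (tarr A tf)) (tε A B′) , t∘ (tε A B) tf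
TmEq-⊢ (tri₁ A B) = t∘ (t⊗ (t𝟙 A) (tη A B)) (tε A (A ⊗ B)) , t𝟙 (A ⊗ B)
TmEq-⊢ (tri₂ A B) = t∘ (tη A (A ⊸ B)) (tarr A (tε A B)) , t𝟙 (A ⊸ B)

-- Typing is unique (⊢-unique), so an equation can be stated once for
-- untyped terms and used at whichever typing either side has.
infix 4 _≃_
_≃_ : Term → Term → Set
f ≃ g = (∀ {A B} → f ∶ A ⊢ B → TmEq A B f g) × (∀ {A B} → g ∶ A ⊢ B → TmEq A B f g)

TmEq⇒≃ : ∀ {A B f g} → TmEq A B f g → f ≃ g
TmEq⇒≃ e = (λ t → retype (proj₁ (TmEq-⊢ e)) t) , (λ t → retype (proj₂ (TmEq-⊢ e)) t)
  where
  retype : ∀ {h A′ B′} → h ∶ _ ⊢ _ → h ∶ A′ ⊢ B′ → TmEq A′ B′ _ _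
  retype t t′ = TmEq-cast (proj₁ (⊢-unique t t′)) (proj₂ (⊢-unique t t′)) e

≃-refl : ∀ {f} → f ≃ f
≃-refl = ≈refl , ≈refl

≃-sym : ∀ {f g} → f ≃ g → g ≃ f
≃-sym (p , q) = (λ t → ≈sym (q t)) , (λ t → ≈sym (p t))

≃-trans : ∀ {f g h} → f ≃ g → g ≃ h → f ≃ h
≃-trans (p , p′) (q , q′) =
  (λ t → let e = p t in ≈trans e (q (proj₂ (TmEq-⊢ e)))) ,
  (λ t → let e = q′ t in ≈trans (p′ (proj₁ (TmEq-⊢ e))) e)

≃-setoid : Setoid _ _
≃-setoid = record
  { Carrier = Term ; _≈_ = _≃_
  ; isEquivalence = record { refl = ≃-refl ; sym = ≃-sym ; trans = ≃-trans } }

open import Relation.Binary.Reasoning.Setoid ≃-setoid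

∘-cong : ∀ {f f′ g g′} → g ≃ g′ → f ≃ f′ → g ∘ f ≃ g′ ∘ f′
∘-cong (q , q′) (p , p′) = (λ { (t∘ tf tg) → ≈∘ (p tf) (q tg) }) , (λ { (t∘ tf tg) → ≈∘ (p′ tf) (q′ tg) })

⊗ᵗ-cong : ∀ {f f′ g g′} → f ≃ f′ → g ≃ g′ → f ⊗ᵗ g ≃ f′ ⊗ᵗ g′
⊗ᵗ-cong (p , p′) (q , q′) = (λ { (t⊗ tf tg) → ≈⊗ (p tf) (q tg) }) , (λ { (t⊗ tf tg) → ≈⊗ (p′ tf) (q′ tg) })

arr-cong : ∀ {f f′} A → f ≃ f′ → arr A f ≃ arr A f′
arr-cong A (p , p′) = (λ { (tarr _ t) → ≈arr A (p t) }) , (λ { (tarr _ t) → ≈arr A (p′ t) })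

∘-congˡ : ∀ {f f′ g} → f ≃ f′ → g ∘ f ≃ g ∘ f′
∘-congˡ = ∘-cong ≃-refl

∘-congʳ : ∀ {f g g′} → g ≃ g′ → g ∘ f ≃ g′ ∘ f
∘-congʳ q = ∘-cong q ≃-refl

⊗ᵗ-congˡ : ∀ {f g g′} → g ≃ g′ → f ⊗ᵗ g ≃ f ⊗ᵗ g′
⊗ᵗ-congˡ = ⊗ᵗ-cong ≃-refl

⊗ᵗ-congʳ : ∀ {f f′ g} → f ≃ f′ → f ⊗ᵗ g ≃ f′ ⊗ᵗ g
⊗ᵗ-congʳ p = ⊗ᵗ-cong p ≃-refl

∘-assoc : ∀ {f g h} → h ∘ (g ∘ f) ≃ (h ∘ g) ∘ f
∘-assoc = (λ { (t∘ (t∘ tf tg) th) → assoc tf tg th }) , (λ { (t∘ tf (t∘ tg th)) → assoc tf tg th })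

⊗ᵗ-assoc : ∀ {f g h} → f ⊗ᵗ (g ⊗ᵗ h) ≃ (f ⊗ᵗ g) ⊗ᵗ h
⊗ᵗ-assoc =
  (λ { (t⊗ tf (t⊗ tg th)) → ⊗-assoc tf tg th }) ,
  (λ { (t⊗ {A₂ = A₃} {B₂ = B₃} (t⊗ {A₁ = A₁} {A₂} {B₁} {B₂} tf tg) th) →
       TmEq-cast (sym (++-assoc A₁ A₂ A₃)) (sym (++-assoc B₁ B₂ B₃)) (⊗-assoc tf tg th) })

⊗ᵗ-identityʳ : ∀ {f} → f ⊗ᵗ 𝟙 I ≃ f
⊗ᵗ-identityʳ =
  (λ { (t⊗ {A₁ = A} {B₁ = B} tf (t𝟙 _)) →
         TmEq-cast (sym (++-identityʳ A)) (sym (++-identityʳ B)) (⊗-unitʳ tf) }) ,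
  ⊗-unitʳ

⊗ᵗ-identityˡ : ∀ {f} → 𝟙 I ⊗ᵗ f ≃ f
⊗ᵗ-identityˡ = (λ { (t⊗ (t𝟙 _) tf) → ⊗-unitˡ tf }) , ⊗-unitˡ

∘-identityʳ : ∀ {g A B} → g ∶ A ⊢ B → g ∘ 𝟙 A ≃ g
∘-identityʳ t = TmEq⇒≃ (idʳ t)

∘-identityˡ : ∀ {f A B} → f ∶ A ⊢ B → 𝟙 B ∘ f ≃ f
∘-identityˡ t = TmEq⇒≃ (idˡ t)

⊗ᵗ-𝟙 : ∀ {A B} → 𝟙 A ⊗ᵗ 𝟙 B ≃ 𝟙 (A ⊗ B)
⊗ᵗ-𝟙 {A} {B} = TmEq⇒≃ (⊗-id A B)

⊗ᵗ-∘ : ∀ {f₁ f₂ g₁ g₂ A₁ A₂ B₁ B₂ C₁ C₂} →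
       f₁ ∶ A₁ ⊢ B₁ → f₂ ∶ A₂ ⊢ B₂ → g₁ ∶ B₁ ⊢ C₁ → g₂ ∶ B₂ ⊢ C₂ →
       (g₁ ⊗ᵗ g₂) ∘ (f₁ ⊗ᵗ f₂) ≃ (g₁ ∘ f₁) ⊗ᵗ (g₂ ∘ f₂)
⊗ᵗ-∘ tf₁ tf₂ tg₁ tg₂ = TmEq⇒≃ (⊗-∘ tf₁ tf₂ tg₁ tg₂)

c-natural : ∀ {f g A A′ B B′} → f ∶ A ⊢ A′ → g ∶ B ⊢ B′ → c A′ B′ ∘ (f ⊗ᵗ g) ≃ (g ⊗ᵗ f) ∘ c A B
c-natural tf tg = TmEq⇒≃ (c-nat tf tg)

c-involutive : ∀ {A B} → c B A ∘ c A B ≃ 𝟙 (A ⊗ B)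
c-involutive {A} {B} = TmEq⇒≃ (c-inv A B)

arr-∘ᵗ : ∀ {A f g} → arr A (g ∘ f) ≃ arr A g ∘ arr A f
arr-∘ᵗ {A} =
  (λ { (tarr _ (t∘ tf tg)) → arr-∘ A tf tg }) , (λ { (t∘ (tarr _ tf) (tarr _ tg)) → arr-∘ A tf tg })

η-natural : ∀ {f B B′} A → f ∶ B ⊢ B′ → η A B′ ∘ f ≃ arr A (𝟙 A ⊗ᵗ f) ∘ η A B
η-natural A t = TmEq⇒≃ (η-nat A t)

ε-natural : ∀ {f B B′} A → f ∶ B ⊢ B′ → ε A B′ ∘ (𝟙 A ⊗ᵗ arr A f) ≃ f ∘ ε A B
ε-natural A t = TmEq⇒≃ (ε-nat A t)

triangle : ∀ {A B} → ε A (A ⊗ B) ∘ (𝟙 A ⊗ᵗ η A B) ≃ 𝟙 (A ⊗ B)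
triangle {A} {B} = TmEq⇒≃ (tri₁ A B)

whisker : Fm → Fm → Term → Term
whisker G E h = 𝟙 G ⊗ᵗ (h ⊗ᵗ 𝟙 E)

whisker-⊢ : ∀ {G E h X Y} → h ∶ X ⊢ Y → whisker G E h ∶ G ⊗ (X ⊗ E) ⊢ G ⊗ (Y ⊗ E)
whisker-⊢ {G} {E} t = t⊗ (t𝟙 G) (t⊗ t (t𝟙 E))

whisker-cong : ∀ {G E h h′} → h ≃ h′ → whisker G E h ≃ whisker G E h′
whisker-cong p = ⊗ᵗ-congˡ (⊗ᵗ-congʳ p)

whisker-∘ : ∀ {G E h k X Y Z} → h ∶ X ⊢ Y → k ∶ Z ⊢ X → whisker G E h ∘ whisker G E k ≃ whisker G E (h ∘ k)
whisker-∘ {G} {E} {h} {k} th tk = begin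
  (𝟙 G ⊗ᵗ (h ⊗ᵗ 𝟙 E)) ∘ (𝟙 G ⊗ᵗ (k ⊗ᵗ 𝟙 E))
    ≈⟨ ⊗ᵗ-∘ (t𝟙 G) (t⊗ tk (t𝟙 E)) (t𝟙 G) (t⊗ th (t𝟙 E)) ⟩
  (𝟙 G ∘ 𝟙 G) ⊗ᵗ ((h ⊗ᵗ 𝟙 E) ∘ (k ⊗ᵗ 𝟙 E))
    ≈⟨ ⊗ᵗ-cong (∘-identityʳ (t𝟙 G)) (⊗ᵗ-∘ tk (t𝟙 E) th (t𝟙 E)) ⟩
  𝟙 G ⊗ᵗ ((h ∘ k) ⊗ᵗ (𝟙 E ∘ 𝟙 E))
    ≈⟨ ⊗ᵗ-congˡ (⊗ᵗ-congˡ (∘-identityʳ (t𝟙 E))) ⟩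
  whisker G E (h ∘ k) ∎

whisker-𝟙 : ∀ {G E X} → whisker G E (𝟙 X) ≃ 𝟙 (G ⊗ (X ⊗ E))
whisker-𝟙 = ≃-trans (⊗ᵗ-congˡ ⊗ᵗ-𝟙) ⊗ᵗ-𝟙

whisker-I : ∀ {h} → whisker I I h ≃ h
whisker-I = ≃-trans ⊗ᵗ-identityˡ ⊗ᵗ-identityʳ

whisker-Iˡ : ∀ {E h} → whisker I E h ≃ h ⊗ᵗ 𝟙 E
whisker-Iˡ = ⊗ᵗ-identityˡ

whisker-whisker : ∀ {G E G₁ E₁ h} → whisker G E (whisker G₁ E₁ h) ≃ whisker (G ⊗ G₁) (E₁ ⊗ E) h
whisker-whisker {G} {E} {G₁} {E₁} {h} = begin
  𝟙 G ⊗ᵗ ((𝟙 G₁ ⊗ᵗ (h ⊗ᵗ 𝟙 E₁)) ⊗ᵗ 𝟙 E) ≈⟨ ⊗ᵗ-congˡ (≃-sym ⊗ᵗ-assoc) ⟩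
  𝟙 G ⊗ᵗ (𝟙 G₁ ⊗ᵗ ((h ⊗ᵗ 𝟙 E₁) ⊗ᵗ 𝟙 E)) ≈⟨ ⊗ᵗ-congˡ (⊗ᵗ-congˡ (≃-sym ⊗ᵗ-assoc)) ⟩
  𝟙 G ⊗ᵗ (𝟙 G₁ ⊗ᵗ (h ⊗ᵗ (𝟙 E₁ ⊗ᵗ 𝟙 E))) ≈⟨ ⊗ᵗ-assoc ⟩
  (𝟙 G ⊗ᵗ 𝟙 G₁) ⊗ᵗ (h ⊗ᵗ (𝟙 E₁ ⊗ᵗ 𝟙 E)) ≈⟨ ⊗ᵗ-cong ⊗ᵗ-𝟙 (⊗ᵗ-congˡ ⊗ᵗ-𝟙) ⟩
  whisker (G ⊗ G₁) (E₁ ⊗ E) h ∎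

𝟙⊗-whisker : ∀ {L G X h} → 𝟙 L ⊗ᵗ whisker G X h ≃ whisker (L ⊗ G) X h
𝟙⊗-whisker = ≃-trans ⊗ᵗ-assoc (⊗ᵗ-congʳ ⊗ᵗ-𝟙)

whisker-⊗𝟙 : ∀ {G X R h} → whisker G X h ⊗ᵗ 𝟙 R ≃ whisker G (X ⊗ R) h
whisker-⊗𝟙 = ≃-trans (≃-sym ⊗ᵗ-assoc) (⊗ᵗ-congˡ (≃-trans (≃-sym ⊗ᵗ-assoc) (⊗ᵗ-congˡ ⊗ᵗ-𝟙)))

⊗ᵗ≃⊗𝟙∘𝟙⊗ : ∀ {f₁ f₂ A₁ B₁ A₂ B₂} → f₁ ∶ A₁ ⊢ B₁ → f₂ ∶ A₂ ⊢ B₂ → (f₁ ⊗ᵗ 𝟙 B₂) ∘ (𝟙 A₁ ⊗ᵗ f₂) ≃ f₁ ⊗ᵗ f₂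
⊗ᵗ≃⊗𝟙∘𝟙⊗ {A₁ = A₁} {B₂ = B₂} t₁ t₂ =
  ≃-trans (⊗ᵗ-∘ (t𝟙 A₁) t₂ t₁ (t𝟙 B₂)) (⊗ᵗ-cong (∘-identityʳ t₁) (∘-identityˡ t₂))

⊗ᵗ≃𝟙⊗∘⊗𝟙 : ∀ {f₁ f₂ A₁ B₁ A₂ B₂} → f₁ ∶ A₁ ⊢ B₁ → f₂ ∶ A₂ ⊢ B₂ → (𝟙 B₁ ⊗ᵗ f₂) ∘ (f₁ ⊗ᵗ 𝟙 A₂) ≃ f₁ ⊗ᵗ f₂
⊗ᵗ≃𝟙⊗∘⊗𝟙 {B₁ = B₁} {A₂ = A₂} t₁ t₂ =
  ≃-trans (⊗ᵗ-∘ t₁ (t𝟙 A₂) (t𝟙 B₁) t₂) (⊗ᵗ-cong (∘-identityˡ t₁) (∘-identityʳ t₂))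

𝟙⊗-∘ : ∀ {P u v A B C} → v ∶ A ⊢ B → u ∶ B ⊢ C → (𝟙 P ⊗ᵗ u) ∘ (𝟙 P ⊗ᵗ v) ≃ 𝟙 P ⊗ᵗ (u ∘ v)
𝟙⊗-∘ {P} tv tu = ≃-trans (⊗ᵗ-∘ (t𝟙 P) tv (t𝟙 P) tu) (⊗ᵗ-congʳ (∘-identityʳ (t𝟙 P)))

⊗𝟙-∘ : ∀ {R u v A B C} → v ∶ A ⊢ B → u ∶ B ⊢ C → (u ⊗ᵗ 𝟙 R) ∘ (v ⊗ᵗ 𝟙 R) ≃ (u ∘ v) ⊗ᵗ 𝟙 R
⊗𝟙-∘ {R} tv tu = ≃-trans (⊗ᵗ-∘ tv (t𝟙 R) tu (t𝟙 R)) (⊗ᵗ-congˡ (∘-identityʳ (t𝟙 R)))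

whisker-split-left : ∀ {P X M Q k} → whisker (P ⊗ (X ⊗ M)) Q k ≃ 𝟙 P ⊗ᵗ (𝟙 X ⊗ᵗ whisker M Q k)
whisker-split-left = ≃-sym (≃-trans (⊗ᵗ-congˡ 𝟙⊗-whisker) 𝟙⊗-whisker)

whisker-disjoint₁ : ∀ P M Q {h k X X′ Y Y′} → h ∶ X ⊢ X′ → k ∶ Y ⊢ Y′ →
  whisker P (M ⊗ (Y′ ⊗ Q)) h ∘ whisker (P ⊗ (X ⊗ M)) Q k ≃ 𝟙 P ⊗ᵗ (h ⊗ᵗ whisker M Q k)
whisker-disjoint₁ P M Q {X = X} th tk =
  ≃-trans (∘-congˡ whisker-split-left)
    (≃-trans (𝟙⊗-∘ (t⊗ (t𝟙 X) (whisker-⊢ tk)) (t⊗ th (t𝟙 (M ⊗ _)))) (⊗ᵗ-congˡ (⊗ᵗ≃⊗𝟙∘𝟙⊗ th (whisker-⊢ tk))))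

whisker-disjoint₂ : ∀ P M Q {h k X X′ Y Y′} → h ∶ X ⊢ X′ → k ∶ Y ⊢ Y′ →
  whisker (P ⊗ (X′ ⊗ M)) Q k ∘ whisker P (M ⊗ (Y ⊗ Q)) h ≃ 𝟙 P ⊗ᵗ (h ⊗ᵗ whisker M Q k)
whisker-disjoint₂ P M Q {X′ = X′} th tk =
  ≃-trans (∘-congʳ whisker-split-left)
    (≃-trans (𝟙⊗-∘ (t⊗ th (t𝟙 (M ⊗ _))) (t⊗ (t𝟙 X′) (whisker-⊢ tk))) (⊗ᵗ-congˡ (⊗ᵗ≃𝟙⊗∘⊗𝟙 th (whisker-⊢ tk))))

-- The context equations let callers supply contexts that agree only up to
-- associativity.
whiskers-commute : ∀ P M Q {h k X X′ Y Y′ L₁ L₂ L₃ L₄} → h ∶ X ⊢ X′ → k ∶ Y ⊢ Y′ →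
  L₁ ≡ M ⊗ (Y′ ⊗ Q) → L₂ ≡ P ⊗ (X ⊗ M) → L₃ ≡ P ⊗ (X′ ⊗ M) → L₄ ≡ M ⊗ (Y ⊗ Q) →
  whisker P L₁ h ∘ whisker L₂ Q k ≃ whisker L₃ Q k ∘ whisker P L₄ h
whiskers-commute P M Q th tk refl refl refl refl =
  ≃-trans (whisker-disjoint₁ P M Q th tk) (≃-sym (whisker-disjoint₂ P M Q th tk))

c-natural-whisker₁ : ∀ {h X X′ L R A} → h ∶ X ⊢ X′ →
  whisker (A ⊗ L) R h ∘ c (L ⊗ (X ⊗ R)) A ≃ c (L ⊗ (X′ ⊗ R)) A ∘ whisker L (R ⊗ A) h
c-natural-whisker₁ {A = A} th =
  ≃-sym (≃-trans (∘-congˡ (≃-sym whisker-⊗𝟙)) (≃-trans (c-natural (whisker-⊢ th) (t𝟙 A)) (∘-congʳ 𝟙⊗-whisker)))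

c-natural-whisker₂ : ∀ {h X X′ L R A} → h ∶ X ⊢ X′ →
  whisker L (R ⊗ A) h ∘ c A (L ⊗ (X ⊗ R)) ≃ c A (L ⊗ (X′ ⊗ R)) ∘ whisker (A ⊗ L) R h
c-natural-whisker₂ {A = A} th =
  ≃-sym (≃-trans (∘-congˡ (≃-sym 𝟙⊗-whisker)) (≃-trans (c-natural (t𝟙 A) (whisker-⊢ th)) (∘-congʳ whisker-⊗𝟙)))

∘-square : ∀ {t V X Y Z} → V ∘ X ≃ Y ∘ Z → (t ∘ V) ∘ X ≃ (t ∘ Y) ∘ Z
∘-square sq = ≃-trans (≃-sym ∘-assoc) (≃-trans (∘-congˡ sq) ∘-assoc)

c-conjugate : ∀ {k X Y G} → k ∶ X ⊢ Y → (c Y G ∘ (k ⊗ᵗ 𝟙 G)) ∘ c G X ≃ 𝟙 G ⊗ᵗ k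
c-conjugate {k} {X} {Y} {G} tk = begin
  (c Y G ∘ (k ⊗ᵗ 𝟙 G)) ∘ c G X   ≈⟨ ∘-congʳ (c-natural tk (t𝟙 G)) ⟩
  ((𝟙 G ⊗ᵗ k) ∘ c X G) ∘ c G X   ≈⟨ ≃-sym ∘-assoc ⟩
  (𝟙 G ⊗ᵗ k) ∘ (c X G ∘ c G X)   ≈⟨ ∘-congˡ c-involutive ⟩
  (𝟙 G ⊗ᵗ k) ∘ 𝟙 (G ⊗ X)         ≈⟨ ∘-identityʳ (t⊗ (t𝟙 G) tk) ⟩
  𝟙 G ⊗ᵗ k ∎

apply : Fm → Fm → Term → Term
apply A B u = ε A B ∘ (u ⊗ᵗ 𝟙 (A ⊸ B))

apply-⊢ : ∀ {u C A B} → u ∶ C ⊢ A → apply A B u ∶ C ⊗ (A ⊸ B) ⊢ B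
apply-⊢ {A = A} {B} tu = t∘ (t⊗ tu (t𝟙 (A ⊸ B))) (tε A B)

→⊢-code : ∀ {u C A B G} → u ∶ C ⊢ A →
  (ε A B ⊗ᵗ 𝟙 G) ∘ (u ⊗ᵗ (𝟙 (A ⊸ B) ⊗ᵗ 𝟙 G)) ≃ apply A B u ⊗ᵗ 𝟙 G
→⊢-code {A = A} {B} tu =
  ≃-sym (≃-trans (≃-sym (⊗𝟙-∘ (t⊗ tu (t𝟙 (A ⊸ B))) (tε A B))) (∘-congˡ (≃-sym ⊗ᵗ-assoc)))

Λ : Fm → Fm → Term → Term
Λ A G t = arr A t ∘ η A G

Λ-⊢ : ∀ {t A G B} → t ∶ A ⊗ G ⊢ B → Λ A G t ∶ G ⊢ A ⊸ B
Λ-⊢ {A = A} {G} tt = t∘ (tη A G) (tarr A tt)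

β-conversion : ∀ {u e C′ C A B} → u ∶ C′ ⊢ A → e ∶ A ⊗ C ⊢ B →
  apply A B u ∘ (𝟙 C′ ⊗ᵗ Λ A C e) ≃ e ∘ (u ⊗ᵗ 𝟙 C)
β-conversion {u} {e} {C′} {C} {A} {B} tu te = begin
  (ε A B ∘ (u ⊗ᵗ 𝟙 (A ⊸ B))) ∘ (𝟙 C′ ⊗ᵗ Λ A C e)
    ≈⟨ ≃-sym ∘-assoc ⟩
  ε A B ∘ ((u ⊗ᵗ 𝟙 (A ⊸ B)) ∘ (𝟙 C′ ⊗ᵗ Λ A C e))
    ≈⟨ ∘-congˡ (≃-trans (⊗ᵗ≃⊗𝟙∘𝟙⊗ tu (Λ-⊢ te)) (≃-sym (⊗ᵗ≃𝟙⊗∘⊗𝟙 tu (Λ-⊢ te)))) ⟩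
  ε A B ∘ ((𝟙 A ⊗ᵗ Λ A C e) ∘ (u ⊗ᵗ 𝟙 C))
    ≈⟨ ∘-congˡ (∘-congʳ (≃-sym (𝟙⊗-∘ (tη A C) (tarr A te)))) ⟩
  ε A B ∘ (((𝟙 A ⊗ᵗ arr A e) ∘ (𝟙 A ⊗ᵗ η A C)) ∘ (u ⊗ᵗ 𝟙 C))
    ≈⟨ ≃-trans ∘-assoc (∘-congʳ ∘-assoc) ⟩
  ((ε A B ∘ (𝟙 A ⊗ᵗ arr A e)) ∘ (𝟙 A ⊗ᵗ η A C)) ∘ (u ⊗ᵗ 𝟙 C)
    ≈⟨ ∘-congʳ (∘-congʳ (ε-natural A te)) ⟩
  ((e ∘ ε A (A ⊗ C)) ∘ (𝟙 A ⊗ᵗ η A C)) ∘ (u ⊗ᵗ 𝟙 C)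
    ≈⟨ ∘-congʳ (≃-trans (≃-sym ∘-assoc) (∘-congˡ triangle)) ⟩
  (e ∘ 𝟙 (A ⊗ C)) ∘ (u ⊗ᵗ 𝟙 C)
    ≈⟨ ∘-congʳ (∘-identityʳ te) ⟩
  e ∘ (u ⊗ᵗ 𝟙 C) ∎

∘-whisker-∘ : ∀ {t v k G E X Y Z} → v ∶ Y ⊢ Z → k ∶ X ⊢ Y →
  (t ∘ whisker G E v) ∘ whisker G E k ≃ t ∘ whisker G E (v ∘ k)
∘-whisker-∘ tv tk = ≃-trans (≃-sym ∘-assoc) (∘-congˡ (whisker-∘ tv tk))

whisker-⊗ᵗ-sequential : ∀ {G E f₁ f₂ C₁ C₂ A₁ A₂} → f₁ ∶ C₁ ⊢ A₁ → f₂ ∶ C₂ ⊢ A₂ →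
  whisker (G ⊗ A₁) E f₂ ∘ whisker G (C₂ ⊗ E) f₁ ≃ whisker G E (f₁ ⊗ᵗ f₂)
whisker-⊗ᵗ-sequential {G} {E} {f₁} {f₂} {C₂ = C₂} {A₁} t₁ t₂ = begin
  whisker (G ⊗ A₁) E f₂ ∘ whisker G (C₂ ⊗ E) f₁
    ≡⟨ cong (λ L → whisker (G ⊗ L) E f₂ ∘ whisker G (C₂ ⊗ E) f₁) (sym (++-identityʳ A₁)) ⟩
  whisker (G ⊗ (A₁ ⊗ I)) E f₂ ∘ whisker G (I ⊗ (C₂ ⊗ E)) f₁
    ≈⟨ whisker-disjoint₂ G I E t₁ t₂ ⟩
  𝟙 G ⊗ᵗ (f₁ ⊗ᵗ whisker I E f₂)
    ≈⟨ ⊗ᵗ-congˡ (≃-trans (⊗ᵗ-congˡ whisker-Iˡ) ⊗ᵗ-assoc) ⟩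
  whisker G E (f₁ ⊗ᵗ f₂) ∎

whisker-c-natural₁ : ∀ G E {h X X′ L R A} → h ∶ X ⊢ X′ →
  whisker (G ⊗ (A ⊗ L)) (R ⊗ E) h ∘ whisker G E (c (L ⊗ (X ⊗ R)) A)
    ≃ whisker G E (c (L ⊗ (X′ ⊗ R)) A) ∘ whisker (G ⊗ L) (R ⊗ (A ⊗ E)) h
whisker-c-natural₁ G E {h} {X} {X′} {L} {R} {A} th = begin
  whisker (G ⊗ (A ⊗ L)) (R ⊗ E) h ∘ whisker G E (c (L ⊗ (X ⊗ R)) A)
    ≈⟨ ∘-congʳ (≃-sym whisker-whisker) ⟩
  whisker G E (whisker (A ⊗ L) R h) ∘ whisker G E (c (L ⊗ (X ⊗ R)) A)
    ≈⟨ whisker-∘ (whisker-⊢ th) (⊢-cast refl (sym (++-assoc A L (X ⊗ R))) (tc (L ⊗ (X ⊗ R)) A)) ⟩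
  whisker G E (whisker (A ⊗ L) R h ∘ c (L ⊗ (X ⊗ R)) A)
    ≈⟨ whisker-cong (c-natural-whisker₁ th) ⟩
  whisker G E (c (L ⊗ (X′ ⊗ R)) A ∘ whisker L (R ⊗ A) h)
    ≈⟨ ≃-sym (whisker-∘ (tc (L ⊗ (X′ ⊗ R)) A) (⊢-cast refl (sym (++-assoc₃ L X′ R A)) (whisker-⊢ th))) ⟩
  whisker G E (c (L ⊗ (X′ ⊗ R)) A) ∘ whisker G E (whisker L (R ⊗ A) h)
    ≈⟨ ∘-congˡ whisker-whisker ⟩
  whisker G E (c (L ⊗ (X′ ⊗ R)) A) ∘ whisker (G ⊗ L) ((R ⊗ A) ⊗ E) h
    ≡⟨ cong (λ M → whisker G E (c (L ⊗ (X′ ⊗ R)) A) ∘ whisker (G ⊗ L) M h) (++-assoc R A E) ⟩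
  whisker G E (c (L ⊗ (X′ ⊗ R)) A) ∘ whisker (G ⊗ L) (R ⊗ (A ⊗ E)) h ∎

whisker-c-natural₂ : ∀ G E {h X X′ L R B} → h ∶ X ⊢ X′ →
  whisker (G ⊗ L) (R ⊗ (B ⊗ E)) h ∘ whisker G E (c B (L ⊗ (X ⊗ R)))
    ≃ whisker G E (c B (L ⊗ (X′ ⊗ R))) ∘ whisker (G ⊗ (B ⊗ L)) (R ⊗ E) h
whisker-c-natural₂ G E {h} {X} {X′} {L} {R} {B} th = begin
  whisker (G ⊗ L) (R ⊗ (B ⊗ E)) h ∘ whisker G E (c B (L ⊗ (X ⊗ R)))
    ≡⟨ cong (λ M → whisker (G ⊗ L) M h ∘ whisker G E (c B (L ⊗ (X ⊗ R)))) (sym (++-assoc R B E)) ⟩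
  whisker (G ⊗ L) ((R ⊗ B) ⊗ E) h ∘ whisker G E (c B (L ⊗ (X ⊗ R)))
    ≈⟨ ∘-congʳ (≃-sym whisker-whisker) ⟩
  whisker G E (whisker L (R ⊗ B) h) ∘ whisker G E (c B (L ⊗ (X ⊗ R)))
    ≈⟨ whisker-∘ (whisker-⊢ th) (⊢-cast refl (++-assoc₃ L X R B) (tc B (L ⊗ (X ⊗ R)))) ⟩
  whisker G E (whisker L (R ⊗ B) h ∘ c B (L ⊗ (X ⊗ R)))
    ≈⟨ whisker-cong (c-natural-whisker₂ th) ⟩
  whisker G E (c B (L ⊗ (X′ ⊗ R)) ∘ whisker (B ⊗ L) R h)
    ≈⟨ ≃-sym (whisker-∘ (tc B (L ⊗ (X′ ⊗ R))) (⊢-cast refl (++-assoc B L (X′ ⊗ R)) (whisker-⊢ th))) ⟩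
  whisker G E (c B (L ⊗ (X′ ⊗ R))) ∘ whisker G E (whisker (B ⊗ L) R h)
    ≈⟨ ∘-congˡ whisker-whisker ⟩
  whisker G E (c B (L ⊗ (X′ ⊗ R))) ∘ whisker (G ⊗ (B ⊗ L)) (R ⊗ E) h ∎

apply-∘-whisker : ∀ {v u h A B G M G′ X X′} → h ∶ X ⊢ X′ → u ∶ G ⊗ (X′ ⊗ M) ⊢ A →
  v ∘ (apply A B (u ∘ whisker G M h) ⊗ᵗ 𝟙 G′)
    ≃ (v ∘ (apply A B u ⊗ᵗ 𝟙 G′)) ∘ whisker G (M ⊗ ((A ⊸ B) ⊗ G′)) h
apply-∘-whisker {v} {u} {h} {A} {B} {G} {M} {G′} {X} {X′} th tu = begin
  v ∘ ((ε A B ∘ ((u ∘ k) ⊗ᵗ 𝟙 ψ)) ⊗ᵗ 𝟙 G′)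
    ≈⟨ ∘-congˡ (⊗ᵗ-congʳ (∘-congˡ (≃-sym (⊗𝟙-∘ tk tu)))) ⟩
  v ∘ ((ε A B ∘ ((u ⊗ᵗ 𝟙 ψ) ∘ (k ⊗ᵗ 𝟙 ψ))) ⊗ᵗ 𝟙 G′)
    ≈⟨ ∘-congˡ (⊗ᵗ-congʳ ∘-assoc) ⟩
  v ∘ ((apply A B u ∘ (k ⊗ᵗ 𝟙 ψ)) ⊗ᵗ 𝟙 G′)
    ≈⟨ ∘-congˡ (≃-sym (⊗𝟙-∘ (t⊗ tk (t𝟙 ψ)) (apply-⊢ tu))) ⟩
  v ∘ ((apply A B u ⊗ᵗ 𝟙 G′) ∘ ((k ⊗ᵗ 𝟙 ψ) ⊗ᵗ 𝟙 G′))
    ≈⟨ ∘-assoc ⟩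
  (v ∘ (apply A B u ⊗ᵗ 𝟙 G′)) ∘ ((k ⊗ᵗ 𝟙 ψ) ⊗ᵗ 𝟙 G′)
    ≈⟨ ∘-congˡ (≃-trans (≃-sym ⊗ᵗ-assoc) (≃-trans (⊗ᵗ-congˡ ⊗ᵗ-𝟙) whisker-⊗𝟙)) ⟩
  (v ∘ (apply A B u ⊗ᵗ 𝟙 G′)) ∘ whisker G (M ⊗ (ψ ⊗ G′)) h ∎
  where
  ψ : Fm
  ψ = A ⊸ B
  k : Term
  k = whisker G M h
  tk : k ∶ G ⊗ (X ⊗ M) ⊢ G ⊗ (X′ ⊗ M)
  tk = whisker-⊢ th

β-whisker : ∀ {u e C′ C A B E} → u ∶ C′ ⊢ A → e ∶ A ⊗ C ⊢ B →
  (e ∘ (u ⊗ᵗ 𝟙 C)) ⊗ᵗ 𝟙 E ≃ (apply A B u ⊗ᵗ 𝟙 E) ∘ whisker C′ E (Λ A C e)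
β-whisker {u} {e} {C′} {C} {A} {B} {E} tu te = ≃-sym (begin
  (apply A B u ⊗ᵗ 𝟙 E) ∘ (𝟙 C′ ⊗ᵗ (Λ A C e ⊗ᵗ 𝟙 E))
    ≈⟨ ∘-congˡ ⊗ᵗ-assoc ⟩
  (apply A B u ⊗ᵗ 𝟙 E) ∘ ((𝟙 C′ ⊗ᵗ Λ A C e) ⊗ᵗ 𝟙 E)
    ≈⟨ ⊗𝟙-∘ (t⊗ (t𝟙 C′) (Λ-⊢ te)) (apply-⊢ tu) ⟩
  (apply A B u ∘ (𝟙 C′ ⊗ᵗ Λ A C e)) ⊗ᵗ 𝟙 E
    ≈⟨ ⊗ᵗ-congʳ (β-conversion tu te) ⟩
  (e ∘ (u ⊗ᵗ 𝟙 C)) ⊗ᵗ 𝟙 E ∎)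

Λ-whisker : ∀ {t h A G E X X′} → h ∶ X ⊢ X′ →
  Λ A (G ⊗ (X ⊗ E)) (t ∘ whisker (A ⊗ G) E h) ≃ Λ A (G ⊗ (X′ ⊗ E)) t ∘ whisker G E h
Λ-whisker {t} {h} {A} {G} {E} {X} {X′} th = begin
  arr A (t ∘ whisker (A ⊗ G) E h) ∘ η A (G ⊗ (X ⊗ E))
    ≈⟨ ∘-congʳ arr-∘ᵗ ⟩
  (arr A t ∘ arr A (whisker (A ⊗ G) E h)) ∘ η A (G ⊗ (X ⊗ E))
    ≈⟨ ≃-sym ∘-assoc ⟩
  arr A t ∘ (arr A (whisker (A ⊗ G) E h) ∘ η A (G ⊗ (X ⊗ E)))
    ≈⟨ ∘-congˡ (∘-congʳ (arr-cong A (≃-sym 𝟙⊗-whisker))) ⟩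
  arr A t ∘ (arr A (𝟙 A ⊗ᵗ whisker G E h) ∘ η A (G ⊗ (X ⊗ E)))
    ≈⟨ ∘-congˡ (≃-sym (η-natural A (whisker-⊢ th))) ⟩
  arr A t ∘ (η A (G ⊗ (X′ ⊗ E)) ∘ whisker G E h)
    ≈⟨ ∘-assoc ⟩
  (arr A t ∘ η A (G ⊗ (X′ ⊗ E))) ∘ whisker G E h ∎

∘whisker-⊗ᵗ : ∀ {G M B′ X X′ C′ E′ h t v} → h ∶ X ⊢ X′ → t ∶ G ⊗ (X′ ⊗ M) ⊢ C′ → v ∶ B′ ⊢ E′ →
  (t ∘ whisker G M h) ⊗ᵗ v ≃ (t ⊗ᵗ v) ∘ whisker G (M ⊗ B′) h
∘whisker-⊗ᵗ {B′ = B′} th tt tv =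
  ≃-trans (⊗ᵗ-congˡ (≃-sym (∘-identityʳ tv)))
    (≃-trans (≃-sym (⊗ᵗ-∘ (whisker-⊢ th) (t𝟙 B′) tt tv)) (∘-congˡ whisker-⊗𝟙))

⊗ᵗ-∘whisker : ∀ {A′ G M X X′ C′ E′ h t u} → h ∶ X ⊢ X′ → u ∶ A′ ⊢ C′ → t ∶ G ⊗ (X′ ⊗ M) ⊢ E′ →
  u ⊗ᵗ (t ∘ whisker G M h) ≃ (u ⊗ᵗ t) ∘ whisker (A′ ⊗ G) M h
⊗ᵗ-∘whisker {A′} th tu tt =
  ≃-trans (⊗ᵗ-congʳ (≃-sym (∘-identityʳ tu)))
    (≃-trans (≃-sym (⊗ᵗ-∘ (t𝟙 A′) (whisker-⊢ th) tu tt)) (∘-congˡ 𝟙⊗-whisker))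

principal-cut-code : ∀ {g r f e C′ C A B E} → f ∶ C′ ⊢ A → e ∶ A ⊗ C ⊢ B → r ≃ e ∘ whisker I C f →
  g ∘ whisker I E r ≃ (g ∘ ((ε A B ⊗ᵗ 𝟙 E) ∘ (f ⊗ᵗ (𝟙 (A ⊸ B) ⊗ᵗ 𝟙 E)))) ∘ whisker (C′ ⊗ I) E (Λ A C e)
principal-cut-code {g} {r} {f} {e} {C′} {C} {A} {B} {E} tf te p = begin
  g ∘ whisker I E r
    ≈⟨ ∘-congˡ (≃-trans (whisker-cong p) (≃-trans whisker-Iˡ (⊗ᵗ-congʳ (∘-congˡ whisker-Iˡ)))) ⟩
  g ∘ ((e ∘ (f ⊗ᵗ 𝟙 C)) ⊗ᵗ 𝟙 E)
    ≈⟨ ∘-congˡ (β-whisker tf te) ⟩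
  g ∘ ((apply A B f ⊗ᵗ 𝟙 E) ∘ whisker C′ E (Λ A C e))
    ≈⟨ ≃-trans ∘-assoc (∘-congʳ (∘-congˡ (≃-sym (→⊢-code tf)))) ⟩
  (g ∘ ((ε A B ⊗ᵗ 𝟙 E) ∘ (f ⊗ᵗ (𝟙 (A ⊸ B) ⊗ᵗ 𝟙 E)))) ∘ whisker C′ E (Λ A C e)
    ≡⟨ cong (λ L → _ ∘ whisker L E (Λ A C e)) (sym (++-identityʳ C′)) ⟩
  (g ∘ ((ε A B ⊗ᵗ 𝟙 E) ∘ (f ⊗ᵗ (𝟙 (A ⊸ B) ⊗ᵗ 𝟙 E)))) ∘ whisker (C′ ⊗ I) E (Λ A C e) ∎

-- Cut-free derivations with prescribed code

code-⊢ : ∀ {A B} (d : Deriv A B) → code d ∶ A ⊢ B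
code-⊢ (ax A) = t𝟙 A
code-⊢ (inter G A B E d) =
  t∘ (⊢-cast (cong (G ⊗_) (++-assoc B A E)) (cong (G ⊗_) (++-assoc A B E)) (whisker-⊢ (tc B A))) (code-⊢ d)
code-⊢ (cut G C A E f g) = t∘ (whisker-⊢ (code-⊢ f)) (code-⊢ g)
code-⊢ (→⊢ C A B G f g) =
  t∘ (t∘ (t⊗ (code-⊢ f) (t⊗ (t𝟙 (A ⊸ B)) (t𝟙 G))) (⊢-cast (++-assoc A (A ⊸ B) G) refl (t⊗ (tε A B) (t𝟙 G))))
     (code-⊢ g)
code-⊢ (⊢→ A G C f) = Λ-⊢ (code-⊢ f)
code-⊢ (⊗⊢⊗ A B C E f g) = t⊗ (code-⊢ f) (code-⊢ g)

data CutFreeDeriv : Fm → Fm → Set where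
  ax    : ∀ A → CutFreeDeriv A A
  inter : ∀ G A B E {D} → CutFreeDeriv (G ⊗ (A ⊗ (B ⊗ E))) D → CutFreeDeriv (G ⊗ (B ⊗ (A ⊗ E))) D
  →⊢    : ∀ C A B G {D} → CutFreeDeriv C A → CutFreeDeriv (B ⊗ G) D → CutFreeDeriv (C ⊗ ((A ⊸ B) ⊗ G)) D
  ⊢→    : ∀ A G C → CutFreeDeriv (A ⊗ G) C → CutFreeDeriv G (A ⊸ C)
  ⊗⊢⊗   : ∀ A B C E → CutFreeDeriv A C → CutFreeDeriv B E → CutFreeDeriv (A ⊗ B) (C ⊗ E)

⌊_⌋ : ∀ {A B} → CutFreeDeriv A B → Deriv A B
⌊ ax A ⌋ = ax A
⌊ inter G A B E d ⌋ = inter G A B E ⌊ d ⌋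
⌊ →⊢ C A B G f g ⌋ = →⊢ C A B G ⌊ f ⌋ ⌊ g ⌋
⌊ ⊢→ A G C f ⌋ = ⊢→ A G C ⌊ f ⌋
⌊ ⊗⊢⊗ A B C E f g ⌋ = ⊗⊢⊗ A B C E ⌊ f ⌋ ⌊ g ⌋

⌊⌋-cutFree : ∀ {A B} (d : CutFreeDeriv A B) → CutFree ⌊ d ⌋
⌊⌋-cutFree (ax A) = cf-ax A
⌊⌋-cutFree (inter G A B E d) = cf-inter G A B E (⌊⌋-cutFree d)
⌊⌋-cutFree (→⊢ C A B G f g) = cf-→⊢ C A B G (⌊⌋-cutFree f) (⌊⌋-cutFree g)
⌊⌋-cutFree (⊢→ A G C f) = cf-⊢→ A G C (⌊⌋-cutFree f)
⌊⌋-cutFree (⊗⊢⊗ A B C E f g) = cf-⊗⊢⊗ A B C E (⌊⌋-cutFree f) (⌊⌋-cutFree g)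

⟦_⟧ : ∀ {A B} → CutFreeDeriv A B → Term
⟦ d ⟧ = code ⌊ d ⌋

⟦⟧-⊢ : ∀ {A B} (d : CutFreeDeriv A B) → ⟦ d ⟧ ∶ A ⊢ B
⟦⟧-⊢ d = code-⊢ ⌊ d ⌋

CutFreeCode : Fm → Fm → Term → Set
CutFreeCode Γ D t = Σ (CutFreeDeriv Γ D) (λ d → ⟦ d ⟧ ≃ t)

CutFreeCode-⊢ : ∀ {Γ D t} → CutFreeCode Γ D t → t ∶ Γ ⊢ D
CutFreeCode-⊢ (d , p) = proj₂ (TmEq-⊢ (proj₁ p (⟦⟧-⊢ d)))

reindex : ∀ {Γ Γ′ D t} → CutFreeCode Γ D t → Γ ≡ Γ′ → CutFreeCode Γ′ D t
reindex r refl = r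

recode : ∀ {Γ D t t′} → t ≃ t′ → CutFreeCode Γ D t → CutFreeCode Γ D t′
recode q (d , p) = d , ≃-trans p q

exactᶜ : ∀ {Γ D} (d : CutFreeDeriv Γ D) → CutFreeCode Γ D ⟦ d ⟧
exactᶜ d = d , ≃-refl

axᶜ : ∀ A → CutFreeCode A A (𝟙 A)
axᶜ A = ax A , ≃-refl

interᶜ : ∀ G A B E {D t} → CutFreeCode (G ⊗ (A ⊗ (B ⊗ E))) D t →
         CutFreeCode (G ⊗ (B ⊗ (A ⊗ E))) D (t ∘ whisker G E (c B A))
interᶜ G A B E (d , p) = inter G A B E d , ∘-congʳ p

→⊢ᶜ : ∀ C A B G {D u v} → CutFreeCode C A u → CutFreeCode (B ⊗ G) D v →
      CutFreeCode (C ⊗ ((A ⊸ B) ⊗ G)) D (v ∘ (apply A B u ⊗ᵗ 𝟙 G))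
→⊢ᶜ C A B G (f , p) (g , q) =
  →⊢ C A B G f g , ∘-cong q (≃-trans (∘-congˡ (⊗ᵗ-congʳ p)) (→⊢-code (CutFreeCode-⊢ (f , p))))

⊢→ᶜ : ∀ A G C {t} → CutFreeCode (A ⊗ G) C t → CutFreeCode G (A ⊸ C) (Λ A G t)
⊢→ᶜ A G C (f , p) = ⊢→ A G C f , ∘-congʳ (arr-cong A p)

⊗⊢⊗ᶜ : ∀ A B C E {u v} → CutFreeCode A C u → CutFreeCode B E v → CutFreeCode (A ⊗ B) (C ⊗ E) (u ⊗ᵗ v)
⊗⊢⊗ᶜ A B C E (f , p) (g , q) = ⊗⊢⊗ A B C E f g , ⊗ᵗ-cong p q

swapᶜ : ∀ X Y {D t} → CutFreeCode (X ⊗ Y) D t → CutFreeCode (Y ⊗ X) D (t ∘ c Y X)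
swapᶜ X Y r =
  reindex (recode (∘-congˡ whisker-I) (interᶜ I X Y I (reindex r (cong (X ⊗_) (sym (++-identityʳ Y))))))
    (cong (Y ⊗_) (++-identityʳ X))

→⊢ᶜ-in : ∀ G C A B H {D u v} → CutFreeCode C A u → CutFreeCode (G ⊗ (B ⊗ H)) D v →
         CutFreeCode (G ⊗ (C ⊗ ((A ⊸ B) ⊗ H))) D (v ∘ whisker G H (apply A B u))
→⊢ᶜ-in G C A B H {u = u} {v} f r =
  recode conjugate
    (swapᶜ (C ⊗ ((A ⊸ B) ⊗ H)) G
      (reindex (→⊢ᶜ C A B (H ⊗ G) f (reindex (swapᶜ G (B ⊗ H) r) (++-assoc B H G)))
               (sym (++-assoc C ((A ⊸ B) ⊗ H) G))))
  where
  k : Term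
  k = apply A B u
  conjugate : ((v ∘ c (B ⊗ H) G) ∘ (k ⊗ᵗ 𝟙 (H ⊗ G))) ∘ c G (C ⊗ ((A ⊸ B) ⊗ H)) ≃ v ∘ whisker G H k
  conjugate = begin
    ((v ∘ c (B ⊗ H) G) ∘ (k ⊗ᵗ 𝟙 (H ⊗ G))) ∘ c G (C ⊗ ((A ⊸ B) ⊗ H))
      ≈⟨ ∘-congʳ (∘-congˡ (≃-trans (⊗ᵗ-congˡ (≃-sym ⊗ᵗ-𝟙)) ⊗ᵗ-assoc)) ⟩
    ((v ∘ c (B ⊗ H) G) ∘ ((k ⊗ᵗ 𝟙 H) ⊗ᵗ 𝟙 G)) ∘ c G (C ⊗ ((A ⊸ B) ⊗ H))
      ≈⟨ ≃-trans (∘-congʳ (≃-sym ∘-assoc)) (≃-sym ∘-assoc) ⟩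
    v ∘ ((c (B ⊗ H) G ∘ ((k ⊗ᵗ 𝟙 H) ⊗ᵗ 𝟙 G)) ∘ c G (C ⊗ ((A ⊸ B) ⊗ H)))
      ≈⟨ ∘-congˡ (c-conjugate (⊢-cast (++-assoc C (A ⊸ B) H) refl
                                  (t⊗ (apply-⊢ (CutFreeCode-⊢ f)) (t𝟙 H)))) ⟩
    v ∘ whisker G H k ∎

data Split (X Y G : Fm) (φ : Factor) (E : Fm) : Set where
  inˡ : ∀ X₂ → X ≡ G ⊗ (φ ∷ X₂) → E ≡ X₂ ⊗ Y → Split X Y G φ E
  inʳ : ∀ G₂ → G ≡ X ⊗ G₂ → Y ≡ G₂ ⊗ (φ ∷ E) → Split X Y G φ E

split : ∀ X Y G {φ E} → X ⊗ Y ≡ G ⊗ (φ ∷ E) → Split X Y G φ E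
split [] Y G eq = inʳ G refl eq
split (x ∷ X) Y [] refl = inˡ X refl refl
split (x ∷ X) Y (y ∷ G) eq with ∷-injective eq
... | refl , eq′ with split X Y G eq′
...   | inˡ X₂ p q = inˡ X₂ (cong (x ∷_) p) q
...   | inʳ G₂ p q = inʳ G₂ (cong (x ∷_) p) q

mutual
  factor-size : Factor → ℕ
  factor-size (var _) = 1
  factor-size (A ⇒ B) = suc (size A + size B)

  size : Fm → ℕ
  size [] = 0
  size (φ ∷ A) = factor-size φ + size A

size-⊗ : ∀ A B → size (A ⊗ B) ≡ size A + size B
size-⊗ [] B = refl
size-⊗ (φ ∷ A) B =
  trans (cong (factor-size φ +_) (size-⊗ A B)) (sym (+-assoc (factor-size φ) (size A) (size B)))

size-⊗-≤ˡ : ∀ A {B n} → size (A ⊗ B) ≤ n → size A ≤ n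
size-⊗-≤ˡ A {B} p = m+n≤o⇒m≤o (size A) (subst (_≤ _) (size-⊗ A B) p)

size-⊗-≤ʳ : ∀ A {B n} → size (A ⊗ B) ≤ n → size B ≤ n
size-⊗-≤ʳ A {B} p = m+n≤o⇒n≤o (size A) (subst (_≤ _) (size-⊗ A B) p)

-- n bounds the size of the cut formula; it decreases only at a principal
-- cut, where cut-⊢→ calls cut-left on A₁ and on B₁.
mutual
  cut-left : ∀ n {C A G E D t} (d : CutFreeDeriv C A) → CutFreeCode (G ⊗ (A ⊗ E)) D t → size A ≤ n →
             CutFreeCode (G ⊗ (C ⊗ E)) D (t ∘ whisker G E ⟦ d ⟧)
  cut-left n (ax _) r _ =
    recode (≃-sym (≃-trans (∘-congˡ whisker-𝟙) (∘-identityʳ (CutFreeCode-⊢ r)))) r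
  cut-left n {G = G} {E} (inter G₁ A₁ B₁ E₁ d) r sz =
    recode (≃-trans (∘-congˡ (≃-sym whisker-whisker)) (∘-whisker-∘ (⟦⟧-⊢ d) tc′))
      (reindex (interᶜ (G ⊗ G₁) A₁ B₁ (E₁ ⊗ E) (reindex (cut-left n d r sz) (regroup A₁ B₁)))
               (sym (regroup B₁ A₁)))
    where
    tc′ : whisker G₁ E₁ (c B₁ A₁) ∶ G₁ ⊗ ((B₁ ⊗ A₁) ⊗ E₁) ⊢ G₁ ⊗ (A₁ ⊗ (B₁ ⊗ E₁))
    tc′ = ⊢-cast refl (cong (G₁ ⊗_) (++-assoc A₁ B₁ E₁)) (whisker-⊢ {G₁} {E₁} (tc B₁ A₁))
    regroup : ∀ X Y → G ⊗ ((G₁ ⊗ (X ⊗ (Y ⊗ E₁))) ⊗ E) ≡ (G ⊗ G₁) ⊗ (X ⊗ (Y ⊗ (E₁ ⊗ E)))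
    regroup X Y = solve Fm-monoid
  cut-left n {G = G} {E} {t = t} (→⊢ C₁ A₁ B₁ G₁ f g) r sz =
    recode eq
      (reindex (→⊢ᶜ-in G C₁ A₁ B₁ (G₁ ⊗ E) (exactᶜ f)
                 (reindex (cut-left n g r sz) (cong (G ⊗_) (++-assoc B₁ G₁ E))))
               (cong (G ⊗_) (sym (++-assoc C₁ ((A₁ ⊸ B₁) ⊗ G₁) E))))
    where
    tf : ⟦ f ⟧ ∶ C₁ ⊢ A₁
    tf = ⟦⟧-⊢ f
    eq : (t ∘ whisker G E ⟦ g ⟧) ∘ whisker G (G₁ ⊗ E) (apply A₁ B₁ ⟦ f ⟧)
           ≃ t ∘ whisker G E ⟦ →⊢ C₁ A₁ B₁ G₁ f g ⟧
    eq = ≃-trans (∘-congˡ (⊗ᵗ-congˡ (≃-trans (⊗ᵗ-congˡ (≃-sym ⊗ᵗ-𝟙)) ⊗ᵗ-assoc)))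
           (≃-trans (∘-whisker-∘ (⟦⟧-⊢ g) (t⊗ (apply-⊢ tf) (t𝟙 G₁)))
             (∘-congˡ (whisker-cong (∘-congˡ (≃-sym (→⊢-code tf))))))
  cut-left zero (⊢→ _ _ _ _) _ ()
  cut-left (suc m) (⊢→ A₁ _ B₁ e) (d , p) (s≤s sz) =
    recode (∘-congʳ p) (cut-⊢→ m e d refl (m+n≤o⇒m≤o (size A₁) sz′) (m+n≤o⇒n≤o (size A₁) sz′))
    where
    sz′ : size A₁ + size B₁ ≤ m
    sz′ = m+n≤o⇒m≤o (size A₁ + size B₁) sz
  cut-left n {G = G} {E} (⊗⊢⊗ C₁ C₂ A₁ A₂ f₁ f₂) r sz =
    reindex
      (recode (≃-trans (≃-sym ∘-assoc) (∘-congˡ (whisker-⊗ᵗ-sequential (⟦⟧-⊢ f₁) (⟦⟧-⊢ f₂))))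
        (cut-left n {G = G} {C₂ ⊗ E} f₁
          (reindex (cut-left n {G = G ⊗ A₁} {E} f₂ (reindex r (regroup G A₁ A₂)) (size-⊗-≤ʳ A₁ sz))
                   (++-assoc G A₁ (C₂ ⊗ E)))
          (size-⊗-≤ˡ A₁ sz)))
      (sym (cong (G ⊗_) (++-assoc C₁ C₂ E)))
    where
    regroup : ∀ X Y Z → X ⊗ ((Y ⊗ Z) ⊗ E) ≡ (X ⊗ Y) ⊗ (Z ⊗ E)
    regroup X Y Z = solve Fm-monoid

  cut-⊢→ : ∀ m {A₁ B₁ C G E Γ D} (e : CutFreeDeriv (A₁ ⊗ C) B₁) (d : CutFreeDeriv Γ D) →
           Γ ≡ G ⊗ ((A₁ ⊸ B₁) ⊗ E) → size A₁ ≤ m → size B₁ ≤ m →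
           CutFreeCode (G ⊗ (C ⊗ E)) D (⟦ d ⟧ ∘ whisker G E (Λ A₁ C ⟦ e ⟧))
  cut-⊢→ m {A₁} {B₁} {C} {G} {E} e (ax _) refl s₁ s₂ =
    recode (≃-sym (∘-identityˡ (whisker-⊢ (Λ-⊢ (⟦⟧-⊢ e)))))
      (⊗⊢⊗ᶜ G (C ⊗ E) G ((A₁ ⊸ B₁) ⊗ E) (axᶜ G) (⊗⊢⊗ᶜ C E (A₁ ⊸ B₁) E (⊢→ᶜ A₁ C B₁ (exactᶜ e)) (axᶜ E)))
  cut-⊢→ m {A₁} {B₁} {C} {G} {E} e (inter G′ A′ B′ E′ d) eq s₁ s₂ with split G′ (B′ ⊗ (A′ ⊗ E′)) G eq
  ... | inˡ X₂ refl refl =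
    recode (∘-square (whiskers-commute G X₂ E′ (Λ-⊢ (⟦⟧-⊢ e)) (tc B′ A′)
                       (cong (X₂ ⊗_) (sym (++-assoc A′ B′ E′))) refl refl
                       (cong (X₂ ⊗_) (sym (++-assoc B′ A′ E′)))))
      (reindex (interᶜ (G ⊗ (C ⊗ X₂)) A′ B′ E′
                 (reindex (cut-⊢→ m {G = G} e d (++-assoc G ((A₁ ⊸ B₁) ⊗ X₂) (A′ ⊗ (B′ ⊗ E′))) s₁ s₂)
                          (sym (regroup A′ B′))))
               (regroup B′ A′))
    where
    regroup : ∀ X Y → (G ⊗ (C ⊗ X₂)) ⊗ (X ⊗ (Y ⊗ E′)) ≡ G ⊗ (C ⊗ (X₂ ⊗ (X ⊗ (Y ⊗ E′))))
    regroup X Y = solve Fm-monoid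
  ... | inʳ G₂ refl eq₂ with split B′ (A′ ⊗ E′) G₂ eq₂
  ...   | inˡ X₂ refl refl =
    recode (∘-square (whisker-c-natural₁ G′ E′ (Λ-⊢ (⟦⟧-⊢ e))))
      (reindex (interᶜ G′ A′ (G₂ ⊗ (C ⊗ X₂)) E′
                 (reindex (cut-⊢→ m {G = G′ ⊗ (A′ ⊗ G₂)} e d (regroup-premise (A₁ ⊸ B₁)) s₁ s₂)
                          (sym (regroup-premise C))))
               regroup-conclusion)
    where
    -- The monoid solver treats φ ∷ X as an atom, so the cut formula is
    -- abstracted as P.
    regroup-premise : ∀ P → G′ ⊗ (A′ ⊗ ((G₂ ⊗ (P ⊗ X₂)) ⊗ E′)) ≡ (G′ ⊗ (A′ ⊗ G₂)) ⊗ (P ⊗ (X₂ ⊗ E′))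
    regroup-premise P = solve Fm-monoid
    regroup-conclusion : G′ ⊗ ((G₂ ⊗ (C ⊗ X₂)) ⊗ (A′ ⊗ E′)) ≡ (G′ ⊗ G₂) ⊗ (C ⊗ (X₂ ⊗ (A′ ⊗ E′)))
    regroup-conclusion = solve Fm-monoid
  ...   | inʳ G₃ refl eq₃ with split A′ E′ G₃ eq₃
  ...     | inˡ X₂ refl refl =
    recode (∘-square (whisker-c-natural₂ G′ E′ (Λ-⊢ (⟦⟧-⊢ e))))
      (reindex (interᶜ G′ (G₃ ⊗ (C ⊗ X₂)) B′ E′
                 (reindex (cut-⊢→ m {G = G′ ⊗ G₃} e d (regroup-premise (A₁ ⊸ B₁)) s₁ s₂)
                          (sym (regroup-premise C))))
               regroup-conclusion)
    where
    regroup-premise : ∀ P → G′ ⊗ ((G₃ ⊗ (P ⊗ X₂)) ⊗ (B′ ⊗ E′)) ≡ (G′ ⊗ G₃) ⊗ (P ⊗ (X₂ ⊗ (B′ ⊗ E′)))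
    regroup-premise P = solve Fm-monoid
    regroup-conclusion : G′ ⊗ (B′ ⊗ ((G₃ ⊗ (C ⊗ X₂)) ⊗ E′)) ≡ (G′ ⊗ (B′ ⊗ G₃)) ⊗ (C ⊗ (X₂ ⊗ E′))
    regroup-conclusion = solve Fm-monoid
  ...     | inʳ G₄ refl refl =
    recode (∘-square (≃-sym (whiskers-commute G′ G₄ E (tc B′ A′) (Λ-⊢ (⟦⟧-⊢ e)) refl
                              (cong (G′ ⊗_) (sym (++-assoc B′ A′ G₄)))
                              (cong (G′ ⊗_) (sym (++-assoc A′ B′ G₄))) refl)))
      (reindex (interᶜ G′ A′ B′ (G₄ ⊗ (C ⊗ E))
                 (reindex (cut-⊢→ m {G = G′ ⊗ (A′ ⊗ (B′ ⊗ G₄))} e d (sym (regroup A′ B′ (A₁ ⊸ B₁))) s₁ s₂)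
                          (regroup A′ B′ C)))
               (sym (regroup B′ A′ C)))
    where
    regroup : ∀ X Y P → (G′ ⊗ (X ⊗ (Y ⊗ G₄))) ⊗ (P ⊗ E) ≡ G′ ⊗ (X ⊗ (Y ⊗ (G₄ ⊗ (P ⊗ E))))
    regroup X Y P = solve Fm-monoid
  cut-⊢→ m {A₁} {B₁} {C} {G} {E} e (→⊢ C′ A′ B′ G′ f g) eq s₁ s₂ with split C′ ((A′ ⊸ B′) ⊗ G′) G eq
  ... | inˡ X₂ refl refl =
    recode (≃-trans (apply-∘-whisker (Λ-⊢ (⟦⟧-⊢ e)) (⟦⟧-⊢ f))
                    (∘-congʳ (∘-congˡ (≃-sym (→⊢-code (⟦⟧-⊢ f))))))
      (reindex (→⊢ᶜ (G ⊗ (C ⊗ X₂)) A′ B′ G′ (cut-⊢→ m {G = G} {X₂} e f refl s₁ s₂) (exactᶜ g))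
               (++-assoc₃ G C X₂ ((A′ ⊸ B′) ⊗ G′)))
  ... | inʳ [] refl refl =
    let r₁ = cut-left m {G = I} {C} f (exactᶜ e) s₁ in
    recode (principal-cut-code (⟦⟧-⊢ f) (⟦⟧-⊢ e) (proj₂ r₁))
      (reindex (cut-left m {G = I} {E} (proj₁ r₁) (exactᶜ g) s₂)
               (trans (++-assoc C′ C E) (cong (_⊗ (C ⊗ E)) (sym (++-identityʳ C′)))))
  ... | inʳ (_ ∷ G₃) refl refl =
    recode (≃-trans (∘-square (≃-trans (∘-congˡ (≃-sym whisker-Iˡ))
                                 (≃-trans (≃-sym (whiskers-commute I G₃ E (apply-⊢ (⟦⟧-⊢ f)) (Λ-⊢ (⟦⟧-⊢ e))
                                                    refl (sym (++-assoc C′ (A′ ⊸ B′) G₃)) refl refl))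
                                          (∘-congʳ whisker-Iˡ))))
                    (∘-congʳ (∘-congˡ (≃-sym (→⊢-code (⟦⟧-⊢ f))))))
      (reindex (→⊢ᶜ C′ A′ B′ (G₃ ⊗ (C ⊗ E)) (exactᶜ f)
                 (reindex (cut-⊢→ m {G = B′ ⊗ G₃} {E} e g (sym (++-assoc B′ G₃ ((A₁ ⊸ B₁) ⊗ E))) s₁ s₂)
                          (++-assoc B′ G₃ (C ⊗ E))))
               (sym (++-assoc C′ ((A′ ⊸ B′) ⊗ G₃) (C ⊗ E))))
  cut-⊢→ m {A₁} {B₁} {C} {G} {E} e (⊢→ A′ _ D′ d) refl s₁ s₂ =
    recode (Λ-whisker (Λ-⊢ (⟦⟧-⊢ e)))
      (⊢→ᶜ A′ (G ⊗ (C ⊗ E)) D′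
        (reindex (cut-⊢→ m {G = A′ ⊗ G} {E} e d (sym (++-assoc A′ G ((A₁ ⊸ B₁) ⊗ E))) s₁ s₂)
                 (++-assoc A′ G (C ⊗ E))))
  cut-⊢→ m {A₁} {B₁} {C} {G} {E} e (⊗⊢⊗ A′ B′ C′ E′ f g) eq s₁ s₂ with split A′ B′ G eq
  ... | inˡ X₂ refl refl =
    recode (∘whisker-⊗ᵗ (Λ-⊢ (⟦⟧-⊢ e)) (⟦⟧-⊢ f) (⟦⟧-⊢ g))
      (reindex (⊗⊢⊗ᶜ (G ⊗ (C ⊗ X₂)) B′ C′ E′ (cut-⊢→ m {G = G} {X₂} e f refl s₁ s₂) (exactᶜ g))
               (++-assoc₃ G C X₂ B′))
  ... | inʳ G₂ refl refl =
    recode (⊗ᵗ-∘whisker (Λ-⊢ (⟦⟧-⊢ e)) (⟦⟧-⊢ f) (⟦⟧-⊢ g))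
      (reindex (⊗⊢⊗ᶜ A′ (G₂ ⊗ (C ⊗ E)) C′ E′ (exactᶜ f) (cut-⊢→ m {G = G₂} {E} e g refl s₁ s₂))
               (sym (++-assoc A′ G₂ (C ⊗ E))))

cutᶜ : ∀ G C A E {D u v} → CutFreeCode C A u → CutFreeCode (G ⊗ (A ⊗ E)) D v →
       CutFreeCode (G ⊗ (C ⊗ E)) D (v ∘ whisker G E u)
cutᶜ G C A E (d , p) r = recode (∘-congˡ (whisker-cong p)) (cut-left (size A) d r ≤-refl)

cut-elimination : ∀ {A B} (d : Deriv A B) → CutFreeCode A B (code d)
cut-elimination (ax A) = axᶜ A
cut-elimination (inter G A B E d) = interᶜ G A B E (cut-elimination d)
cut-elimination (cut G C A E f g) = cutᶜ G C A E (cut-elimination f) (cut-elimination g)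
cut-elimination (→⊢ C A B G f g) =
  recode (∘-congˡ (≃-sym (→⊢-code (code-⊢ f)))) (→⊢ᶜ C A B G (cut-elimination f) (cut-elimination g))
cut-elimination (⊢→ A G C f) = ⊢→ᶜ A G C (cut-elimination f)
cut-elimination (⊗⊢⊗ A B C E f g) = ⊗⊢⊗ᶜ A B C E (cut-elimination f) (cut-elimination g)

theorem4p5 : ∀ {A B : Fm} (f : Term) → (d : Deriv A B) → code d ≡ f →
    Σ (Deriv A B) (λ d′ → CutFree d′ × TmEq A B (code d′) f)
theorem4p5 f d refl with cut-elimination d
... | d′ , p = ⌊ d′ ⌋ , ⌊⌋-cutFree d′ , proj₁ p (⟦⟧-⊢ d′)
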